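{- Let $n$ be even. There is no feasible, single-break, ranking-fair schedule for $n$ teams whose D-sequence contains four consecutive entries equal to $2$ (the sub-sequence $2222$).
   Context: Teams are $T=\{1,\dots,n\}$, ranked by strength: team $i$ is stronger than team $j$ iff $i<j$. Rounds are $\{1,\dots,n-1\}$. A schedule assigns to each unordered pair of distinct teams a round and designates which of the two plays at home (the other away); it is feasible if every team plays exactly one game in every round. The ranking HAP of team $i$ is the vector $(p_1,\dots,p_{n-1})$, $p_m\in\{H,A\}$ indicating whether $i$ plays home or away against its $m$-th strongest opponent; the schedule is ranking-fair if every team's ranking HAP alternates between $H$ and $A$. The HAP of a team is $(h_1,\dots,h_{n-1})$ with $h_r$ its venue in round $r$, read cyclically ($h_0:=h_{n-1}$); a break occurs in round $r$ if $h_{r-1}=h_r$; the schedule is single-break if every team has exactly one break. In a feasible single-break schedule the breaks occur in exactly $n/2$ distinct rounds $r_1<\dots<r_{n/2}$; the D-sequence is $(d_1,\dots,d_{n/2})$ with $d_i=r_{i+1}-r_i$ and $r_{n/2+1}:=r_1+n-1$. D-sequences are considered up to cyclic rotation and reversal (corresponding to cyclically shifting or reversing the order of rounds). -}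

module Defs where

open import Data.Nat using (ℕ; zero; suc; _+_; _∸_; _≤_; _≡ᵇ_)
open import Data.Bool using (Bool; true; false; not; _∧_; _∨_; if_then_else_)
open import Data.Fin using (Fin; toℕ)
open import Data.Fin.Properties using () renaming (_≟_ to _≟ᶠ_)
open import Data.List using (List; []; _∷_; _++_; map; length; reverse; allFin; applyUpTo; filterᵇ)
open import Data.Bool.ListAction using (any)
open import Data.Unit using (⊤)
open import Data.Product using (Σ; _×_; ∃; _,_)
open import Data.Sum using (_⊎_)
open import Relation.Nullary using (¬_; ⌊_⌋)
open import Relation.Binary.PropositionalEquality using (_≡_; _≢_)

-- Teams are Fin n; team i (Fin) corresponds to paper team toℕ i + 1,
-- so smaller index = stronger. Rounds are natural numbers 1 .. n-1.

-- A schedule: for each (ordered) pair of teams the round in which they meet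
-- and whether the first plays at home.  Values on the diagonal are irrelevant.
record Schedule (n : ℕ) : Set where
  field
    rnd  : Fin n → Fin n → ℕ
    home : Fin n → Fin n → Bool
open Schedule public

rounds : ℕ → List ℕ
rounds n = applyUpTo suc (n ∸ 1)

WellFormed : ∀ {n} → Schedule n → Set
WellFormed {n} s =
  ∀ (i j : Fin n) → i ≢ j →
    (rnd s i j ≡ rnd s j i) × (home s i j ≡ not (home s j i)) ×
    (1 ≤ rnd s i j) × (rnd s i j ≤ n ∸ 1)

Feasible : ∀ {n} → Schedule n → Set
Feasible {n} s = WellFormed s ×
  (∀ (i : Fin n) (r : ℕ) → 1 ≤ r → r ≤ n ∸ 1 →
     Σ (Fin n) λ j → (j ≢ i) × (rnd s i j ≡ r) ×
       (∀ (j' : Fin n) → j' ≢ i → rnd s i j' ≡ r → j' ≡ j))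

-- opponents of team i, ordered from strongest to weakest
opponents : ∀ {n} → Fin n → List (Fin n)
opponents {n} i = filterᵇ (λ j → not ⌊ j ≟ᶠ i ⌋) (allFin n)

rankingHAP : ∀ {n} → Schedule n → Fin n → List Bool
rankingHAP s i = map (home s i) (opponents i)

Alternating : List Bool → Set
Alternating []            = ⊤
Alternating (x ∷ [])      = ⊤
Alternating (x ∷ y ∷ xs)  = (x ≢ y) × Alternating (y ∷ xs)

RankingFair : ∀ {n} → Schedule n → Set
RankingFair {n} s = ∀ (i : Fin n) → Alternating (rankingHAP s i)

-- venue of team i in round r: the home flag against the (in a feasible
-- schedule unique) opponent j ≠ i with rnd i j = r
firstVenue : ∀ {n} → Schedule n → Fin n → ℕ → List (Fin n) → Bool
firstVenue s i r []       = false
firstVenue s i r (j ∷ js) = if rnd s i j ≡ᵇ r then home s i j else firstVenue s i r js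

venue : ∀ {n} → Schedule n → Fin n → ℕ → Bool
venue s i r = firstVenue s i r (opponents i)

HAP : ∀ {n} → Schedule n → Fin n → List Bool
HAP {n} s i = map (venue s i) (rounds n)

-- cyclic predecessor round: prev 1 = n-1 (h_0 := h_{n-1})
prevRound : ℕ → ℕ → ℕ
prevRound n zero          = n ∸ 1
prevRound n (suc zero)    = n ∸ 1
prevRound n (suc (suc k)) = suc k

_==ᴮ_ : Bool → Bool → Bool
true  ==ᴮ b = b
false ==ᴮ b = not b

breakAt : ∀ {n} → Schedule n → Fin n → ℕ → Bool
breakAt {n} s i r = venue s i (prevRound n r) ==ᴮ venue s i r

SingleBreak : ∀ {n} → Schedule n → Set
SingleBreak {n} s =
  ∀ (i : Fin n) → length (filterᵇ (breakAt s i) (rounds n)) ≡ 1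

breakRounds : ∀ {n} → Schedule n → List ℕ
breakRounds {n} s =
  filterᵇ (λ r → any (λ i → breakAt s i r) (allFin n)) (rounds n)

-- cyclic differences of an increasing list of rounds r_1 < ... < r_k,
-- with r_{k+1} := r_1 + n - 1
dseqAux : ℕ → ℕ → List ℕ → List ℕ
dseqAux n first []           = []
dseqAux n first (x ∷ [])     = (first + (n ∸ 1) ∸ x) ∷ []
dseqAux n first (x ∷ y ∷ rs) = (y ∸ x) ∷ dseqAux n first (y ∷ rs)

cyclicDiffs : ℕ → List ℕ → List ℕ
cyclicDiffs n []       = []
cyclicDiffs n (r ∷ rs) = dseqAux n r (r ∷ rs)

DSequence : ∀ {n} → Schedule n → List ℕ
DSequence {n} s = cyclicDiffs n (breakRounds s)

Rotation : List ℕ → List ℕ → Set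
Rotation d e = Σ (List ℕ) λ as → Σ (List ℕ) λ bs → (d ≡ as ++ bs) × (e ≡ bs ++ as)

ContainsUpToSymmetry : List ℕ → List ℕ → Set
ContainsUpToSymmetry p d =
  Σ (List ℕ) λ e → (Rotation d e ⊎ Rotation (reverse d) e) ×
    Σ (List ℕ) λ ys → e ≡ p ++ ys

{-# OPTIONS --safe #-}
module Submission where

open import Defs
open import Data.Nat using (ℕ; zero; suc; _+_; _*_; _∸_; _≤_; _<_; z≤n; s≤s; s≤s⁻¹; _%_;
  NonZero; >-nonZero⁻¹; _≡ᵇ_; _<ᵇ_; _≤?_; _<?_)
open import Data.Nat.Properties
open import Data.Nat.DivMod
open import Data.Nat.Divisibility using (_∣_; divides)
open import Data.Nat.ListAction using (sum)
open import Data.Nat.ListAction.Properties using (sum-++; sum-↭)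
open import Data.Bool using (Bool; true; false; not; T)
open import Data.Bool.Properties using (T?; T-≡; not-injective; not-involutive; ¬-not; not-¬)
open import Data.Bool.ListAction using (any)
open import Data.Fin using (Fin; toℕ; #_; punchIn; punchOut; fromℕ<) renaming (zero to fzero; suc to fsuc)
open import Data.Fin.Properties using (toℕ-fromℕ<; toℕ-injective; toℕ<n; punchIn-punchOut;
  punchOut-punchIn; punchOut-cong; punchInᵢ≢i; ¬∀⟶∃¬) renaming (_≟_ to _≟ᶠ_)
open import Data.Fin.Permutation using (permutation)
open import Data.List using (List; []; _∷_; _++_; map; reverse; replicate; length; filterᵇ; allFin;
  applyUpTo; tabulate)
open import Data.List.Properties using (++-assoc; reverse-++; reverse-involutive; ∷-injective;
  map-tabulate; filter-all)
open import Data.List.Relation.Binary.Permutation.Propositional.Properties using (↭-reverse)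
open import Data.List.Relation.Unary.All as All using (All; []; _∷_)
open import Data.List.Relation.Unary.All.Properties using (tabulate⁺)
open import Data.List.Relation.Unary.Any using (here; there; satisfied)
open import Data.List.Relation.Unary.Any.Properties using (any⁻)
open import Data.List.Relation.Unary.Linked using (Linked; _∷_)
open import Data.List.Relation.Unary.Linked.Properties using (filter⁺; applyUpTo⁺₂)
open import Data.List.Membership.Propositional using (_∈_)
open import Data.List.Membership.Propositional.Properties using (∈-++⁻; ∈-map⁻; ∈-filter⁺;
  ∈-filter⁻; ∈-allFin; ∈-applyUpTo⁺; ∈-applyUpTo⁻)
open import Data.Product using (∃; ∃₂; _×_; _,_; proj₁; proj₂; map₂)
open import Data.Sum using (inj₁; inj₂)
open import Data.Empty using (⊥; ⊥-elim)
open import Data.Unit using (tt)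
open import Function using (_∘_; Equivalence)
open import Relation.Nullary using (¬_; yes; no; ⌊_⌋; contradiction)
open import Relation.Binary.Definitions using (tri<; tri≈; tri>)
open import Relation.Binary.PropositionalEquality
open import Algebra.Properties.CommutativeMonoid.Sum +-0-commutativeMonoid
  using (sum-syntax; sum-cong-≗; sum-permute; ∑-distrib-+; sum-remove)

-- Write n = M + 1, so M (the number of rounds) is odd. A run 2,2,2,2 in the D-sequence
-- gives break rounds a, a+2, a+4, a+6, a+8 (read cyclically). Every round has exactly n/2
-- home teams, so a break round always contains an HH break; this yields teams t₀,…,t₄ with
-- t_p breaking (HH) in round a+2p. A team with a single HH break alternates everywhere
-- else, so relative to a it plays at home in round a+j iff j is even after its break and
-- odd before it; hence t_p and t_q (p < q) meet in a round a+j with 2p ≤ j < 2q, and t_p is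
-- the home team iff j is even. Counting home games, an HH-break team has (M+1)/2 of them,
-- which ranking-fairness (for M odd) only allows if it plays at home exactly against its
-- even-ranked opponents; among such teams "plays at home against" is a transitive
-- tournament. A parity case analysis shows that the meeting rounds of t₀,…,t₄ cannot satisfy
-- all these constraints.

even : ℕ → Bool
even zero          = true
even (suc zero)    = false
even (suc (suc n)) = even n

even-suc : ∀ n → even (suc n) ≡ not (even n)
even-suc zero          = refl
even-suc (suc zero)    = refl
even-suc (suc (suc n)) = even-suc n

even-+-self : ∀ n → even (n + n) ≡ true
even-+-self zero    = refl
even-+-self (suc n) = trans (cong (even ∘ suc) (+-suc n n)) (even-+-self n)

even-2* : ∀ n → even (2 * n) ≡ true
even-2* n = trans (cong (λ k → even (n + k)) (+-identityʳ n)) (even-+-self n)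

2∣⇒even : ∀ {n} → 2 ∣ n → even n ≡ true
2∣⇒even (divides q refl) = trans (cong even (*-comm q 2)) (even-2* q)

even-injective-on-pair : ∀ lo {x y} → lo ≤ x → x < 2 + lo → lo ≤ y → y < 2 + lo →
                         even x ≡ even y → x ≡ y
even-injective-on-pair zero {0} {0} _ _ _ _ _ = refl
even-injective-on-pair zero {1} {1} _ _ _ _ _ = refl
even-injective-on-pair zero {0} {1} _ _ _ _ ()
even-injective-on-pair zero {1} {0} _ _ _ _ ()
even-injective-on-pair zero {suc (suc _)} _ (s≤s (s≤s ())) _ _ _
even-injective-on-pair zero {_} {suc (suc _)} _ _ _ (s≤s (s≤s ())) _
even-injective-on-pair (suc lo) {suc x} {suc y} (s≤s lo≤x) (s≤s x<) (s≤s lo≤y) (s≤s y<) eq =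
  cong suc (even-injective-on-pair lo lo≤x x< lo≤y y<
    (not-injective (trans (sym (even-suc x)) (trans eq (even-suc y)))))

≢-≢⇒≡ : ∀ {x y z : Bool} → x ≢ y → y ≢ z → x ≡ z
≢-≢⇒≡ x≢y y≢z = trans (¬-not x≢y) (sym (¬-not (y≢z ∘ sym)))

-- j p q stands for the round, counted from a, in which the teams breaking in rounds a + 2p and
-- a + 2q meet.
module _ (j : Fin 5 → Fin 5 → ℕ)
  (j-comm : ∀ {p q} → p ≢ q → j p q ≡ j q p)
  (j-bounds : ∀ {p q} → toℕ p < toℕ q → 2 * toℕ p ≤ j p q × j p q < 2 * toℕ q)
  (j-parity : ∀ {p q r} → toℕ p < toℕ q → toℕ q < toℕ r →
              even (j p q) ≡ even (j q r) → even (j p r) ≡ even (j p q))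
  (j-injective : ∀ {p q r} → p ≢ q → p ≢ r → q ≢ r → j p q ≢ j p r)
  where

  private
    <-lit : ∀ {m n} → T (m <ᵇ n) → m < n
    <-lit = <ᵇ⇒< _ _

    <⇒≢ᶠ : ∀ {p q : Fin 5} → toℕ p < toℕ q → p ≢ q
    <⇒≢ᶠ p<q = <⇒≢ p<q ∘ cong toℕ

    lower : ∀ {p q} → toℕ p < toℕ q → 2 * toℕ p ≤ j p q
    lower = proj₁ ∘ j-bounds

    upper : ∀ {p q} → toℕ p < toℕ q → j p q < 2 * toℕ q
    upper = proj₂ ∘ j-bounds

    j-injectiveʳ : ∀ {p q r} → p ≢ q → p ≢ r → q ≢ r → j q p ≢ j r p
    j-injectiveʳ p≢q p≢r q≢r jqp≡jrp =
      j-injective p≢q p≢r q≢r (trans (j-comm p≢q) (trans jqp≡jrp (sym (j-comm p≢r))))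

    -- If j p q and j q r had the same parity, j p r would coincide with one of them.
    consecutive-parities-differ : ∀ {p q r} lo → toℕ p < toℕ q → toℕ q < toℕ r →
      lo ≤ j p q × j p q < 2 + lo → 2 + lo ≤ j q r × j q r < 4 + lo → lo ≤ j p r × j p r < 4 + lo →
      even (j p q) ≢ even (j q r)
    consecutive-parities-differ {p} {q} {r} lo p<q q<r (lpq , upq) (lqr , uqr) (lpr , upr) eq
      with j p r <? 2 + lo
    ... | yes upr′ = j-injective (<⇒≢ᶠ p<q) (<⇒≢ᶠ (<-trans p<q q<r)) (<⇒≢ᶠ q<r)
          (even-injective-on-pair lo lpq upq lpr upr′ (sym (j-parity p<q q<r eq)))
    ... | no lpr′ = j-injectiveʳ (<⇒≢ᶠ (<-trans p<q q<r) ∘ sym) (<⇒≢ᶠ q<r ∘ sym) (<⇒≢ᶠ p<q)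
          (even-injective-on-pair (2 + lo) (≮⇒≥ lpr′) upr lqr uqr (trans (j-parity p<q q<r eq) eq))

    j01 j12 j23 j34 j03 j13 j14 : ℕ
    j01 = j (# 0) (# 1)
    j12 = j (# 1) (# 2)
    j23 = j (# 2) (# 3)
    j34 = j (# 3) (# 4)
    j03 = j (# 0) (# 3)
    j13 = j (# 1) (# 3)
    j14 = j (# 1) (# 4)

    parity-01≢12 : even j01 ≢ even j12
    parity-01≢12 = consecutive-parities-differ 0 (<-lit _) (<-lit _)
      (j-bounds (<-lit _)) (j-bounds (<-lit _)) (j-bounds (<-lit _))

    parity-12≢23 : even j12 ≢ even j23
    parity-12≢23 = consecutive-parities-differ 2 (<-lit _) (<-lit _)
      (j-bounds (<-lit _)) (j-bounds (<-lit _)) (j-bounds (<-lit _))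

    parity-23≢34 : even j23 ≢ even j34
    parity-23≢34 = consecutive-parities-differ 4 (<-lit _) (<-lit _)
      (j-bounds (<-lit _)) (j-bounds (<-lit _)) (j-bounds (<-lit _))

    parity-01≡23 : even j01 ≡ even j23
    parity-01≡23 = ≢-≢⇒≡ parity-01≢12 parity-12≢23

    parity-12≡34 : even j12 ≡ even j34
    parity-12≡34 = ≢-≢⇒≡ parity-12≢23 parity-23≢34

    parity-03 : even j01 ≡ even j13 → even j03 ≡ even j01
    parity-03 = j-parity (<-lit _) (<-lit _)

    parity-14 : even j13 ≡ even j12 → even j14 ≡ even j13
    parity-14 13≡12 = j-parity (<-lit _) (<-lit _) (trans 13≡12 parity-12≡34)

    parity-13≢01 : even j13 ≢ even j01
    parity-13≢01 13≡01 with j13 <? 4 | j03 <? 2 | j03 <? 4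
    ... | no j13≮4 | _ | _ = j-injectiveʳ {# 3} (λ ()) (λ ()) (λ ())
      (even-injective-on-pair 4 (≮⇒≥ j13≮4) (upper (<-lit _)) (lower (<-lit _)) (upper (<-lit _))
        (trans 13≡01 parity-01≡23))
    ... | yes _ | yes j03<2 | _ = j-injective {# 0} (λ ()) (λ ()) (λ ())
      (even-injective-on-pair 0 z≤n (upper (<-lit _)) z≤n j03<2 (sym (parity-03 (sym 13≡01))))
    ... | yes j13<4 | no j03≮2 | yes j03<4 = j-injectiveʳ {# 3} (λ ()) (λ ()) (λ ())
      (even-injective-on-pair 2 (≮⇒≥ j03≮2) j03<4 (lower (<-lit _)) j13<4
        (trans (parity-03 (sym 13≡01)) (sym 13≡01)))
    ... | yes _ | no _ | no j03≮4 = j-injectiveʳ {# 3} (λ ()) (λ ()) (λ ())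
      (even-injective-on-pair 4 (≮⇒≥ j03≮4) (upper (<-lit _)) (lower (<-lit _)) (upper (<-lit _))
        (trans (parity-03 (sym 13≡01)) parity-01≡23))

    parity-13≢12 : even j13 ≢ even j12
    parity-13≢12 13≡12 with j13 <? 4 | j14 <? 4 | j14 <? 6
    ... | yes j13<4 | _ | _ = j-injective {# 1} (λ ()) (λ ()) (λ ())
      (even-injective-on-pair 2 (lower (<-lit _)) (upper (<-lit _)) (lower (<-lit _)) j13<4 (sym 13≡12))
    ... | no _ | yes j14<4 | _ = j-injective {# 1} (λ ()) (λ ()) (λ ())
      (even-injective-on-pair 2 (lower (<-lit _)) (upper (<-lit _)) (lower (<-lit _)) j14<4
        (sym (trans (parity-14 13≡12) 13≡12)))
    ... | no j13≮4 | no j14≮4 | yes j14<6 = j-injective {# 1} (λ ()) (λ ()) (λ ())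
      (even-injective-on-pair 4 (≮⇒≥ j13≮4) (upper (<-lit _)) (≮⇒≥ j14≮4) j14<6 (sym (parity-14 13≡12)))
    ... | no _ | no _ | no j14≮6 = j-injectiveʳ {# 4} (λ ()) (λ ()) (λ ())
      (even-injective-on-pair 6 (≮⇒≥ j14≮6) (upper (<-lit _)) (lower (<-lit _)) (upper (<-lit _))
        (trans (parity-14 13≡12) (trans 13≡12 parity-12≡34)))

  no-five-team-meeting-rounds : ⊥
  no-five-team-meeting-rounds = parity-13≢12 (≢-≢⇒≡ parity-13≢01 parity-01≢12)

alternating-agree : ∀ {φ ψ : ℕ → Bool} {lo hi} →
  (∀ j → lo ≤ j → suc j < hi → φ (suc j) ≢ φ j) → (∀ j → ψ (suc j) ≡ not (ψ j)) →
  φ lo ≡ ψ lo → ∀ {j} → lo ≤ j → j < hi → φ j ≡ ψ j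
alternating-agree alt ψ-alt start lo≤j j<hi with m≤n⇒m<n∨m≡n lo≤j
... | inj₂ refl = start
... | inj₁ (s≤s {n = i} lo≤i) =
  trans (¬-not (alt i lo≤i j<hi))
        (trans (cong not (alternating-agree alt ψ-alt start lo≤i (<-trans (n<1+n i) j<hi)))
               (sym (ψ-alt i)))

==ᴮ-true : ∀ b → (b ==ᴮ true) ≡ b
==ᴮ-true true  = refl
==ᴮ-true false = refl

not-==ᴮ : ∀ b c → (not b ==ᴮ c) ≡ (b ==ᴮ not c)
not-==ᴮ true  c = refl
not-==ᴮ false c = sym (not-involutive c)

==ᴮ⇒≡ : ∀ {a b} → (a ==ᴮ b) ≡ true → a ≡ b
==ᴮ⇒≡ {true}  {true}  _ = refl
==ᴮ⇒≡ {false} {false} _ = refl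

==ᴮ⇒≢ : ∀ {a b} → (a ==ᴮ b) ≡ false → a ≢ b
==ᴮ⇒≢ {true}  {false} _ ()
==ᴮ⇒≢ {false} {true}  _ ()

alternating-tabulate : ∀ {k} (g : Fin (suc k) → Bool) → Alternating (tabulate g) →
                       ∀ i → g i ≡ (g fzero ==ᴮ even (toℕ i))
alternating-tabulate g _ fzero = sym (==ᴮ-true (g fzero))
alternating-tabulate {suc k} g (g0≢g1 , alt) (fsuc i) = begin
  g (fsuc i)                         ≡⟨ alternating-tabulate (g ∘ fsuc) alt i ⟩
  (g (fsuc fzero) ==ᴮ even (toℕ i))  ≡⟨ cong (_==ᴮ even (toℕ i)) (¬-not (g0≢g1 ∘ sym)) ⟩
  (not (g fzero) ==ᴮ even (toℕ i))   ≡⟨ not-==ᴮ (g fzero) (even (toℕ i)) ⟩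
  (g fzero ==ᴮ not (even (toℕ i)))   ≡⟨ cong (g fzero ==ᴮ_) (even-suc (toℕ i)) ⟨
  (g fzero ==ᴮ even (suc (toℕ i)))   ∎
  where open ≡-Reasoning

bit : Bool → ℕ
bit true  = 1
bit false = 0

bit+bit≥2 : ∀ {a b} → 2 ≤ bit a + bit b → a ≡ true × b ≡ true
bit+bit≥2 {true}  {true}  _ = refl , refl
bit+bit≥2 {true}  {false} (s≤s ())
bit+bit≥2 {false} {true}  (s≤s ())

∑-ones : ∀ k → ∑[ i < k ] 1 ≡ k
∑-ones zero    = refl
∑-ones (suc k) = cong suc (∑-ones k)

∑-complement : ∀ {k} (f : Fin k → Bool) → ∑[ i < k ] bit (not (f i)) + ∑[ i < k ] bit (f i) ≡ k
∑-complement {k} f = begin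
  ∑[ i < k ] bit (not (f i)) + ∑[ i < k ] bit (f i)  ≡⟨ ∑-distrib-+ (bit ∘ not ∘ f) (bit ∘ f) ⟨
  ∑[ i < k ] (bit (not (f i)) + bit (f i))           ≡⟨ sum-cong-≗ (bit-not ∘ f) ⟩
  ∑[ i < k ] 1                                       ≡⟨ ∑-ones k ⟩
  k                                                  ∎
  where
  open ≡-Reasoning
  bit-not : ∀ b → bit (not b) + bit b ≡ 1
  bit-not true  = refl
  bit-not false = refl

∑-≤-length : ∀ {k} (f : Fin k → ℕ) → (∀ i → f i ≤ 1) → ∑[ i < k ] f i ≤ k
∑-≤-length {zero}  f _   = z≤n
∑-≤-length {suc k} f f≤1 = +-mono-≤ (f≤1 fzero) (∑-≤-length (f ∘ fsuc) (f≤1 ∘ fsuc))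

pigeonhole : ∀ {k} (f : Fin (suc k) → ℕ) z → f z ≡ 0 → suc k ≤ ∑[ i < suc k ] f i →
             ∃ λ i → 2 ≤ f i
pigeonhole {k} f z fz≡0 k<∑ =
  map₂ ≰⇒> (¬∀⟶∃¬ (suc k) (λ i → f i ≤ 1) (λ i → f i ≤? 1) all-≤1⇒∑≤k)
  where
  all-≤1⇒∑≤k : ¬ (∀ i → f i ≤ 1)
  all-≤1⇒∑≤k f≤1 = <⇒≱ k<∑ (begin
    ∑[ i < suc k ] f i                 ≡⟨ sum-remove {i = z} f ⟩
    f z + ∑[ i < k ] f (punchIn z i)   ≡⟨ cong (_+ ∑[ i < k ] f (punchIn z i)) fz≡0 ⟩
    ∑[ i < k ] f (punchIn z i)         ≤⟨ ∑-≤-length (f ∘ punchIn z) (f≤1 ∘ punchIn z) ⟩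
    k                                  ∎)
    where open ≤-Reasoning

+-self-injective : ∀ {a b} → a + a ≡ b + b → a ≡ b
+-self-injective {zero}  {zero}  _  = refl
+-self-injective {suc a} {suc b} eq = cong suc (+-self-injective
  (suc-injective (trans (sym (+-suc a a)) (trans (suc-injective eq) (+-suc b b)))))

length-≥2 : ∀ {A : Set} {x y : A} {xs} → x ∈ xs → y ∈ xs → x ≢ y → 2 ≤ length xs
length-≥2 (here refl) (here refl) x≢y = contradiction refl x≢y
length-≥2 {xs = _ ∷ _ ∷ _} (here refl) (there _) _ = s≤s (s≤s z≤n)
length-≥2 {xs = _ ∷ _ ∷ _} (there _) (here refl) _ = s≤s (s≤s z≤n)
length-≥2 (there x∈) (there y∈) x≢y = m≤n⇒m≤1+n (length-≥2 x∈ y∈ x≢y)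

does-≟-suc : ∀ {n} (j x : Fin n) → ⌊ fsuc j ≟ᶠ fsuc x ⌋ ≡ ⌊ j ≟ᶠ x ⌋
does-≟-suc j x with j ≟ᶠ x
... | yes _ = refl
... | no _  = refl

filter-tabulate-punchIn : ∀ {A : Set} {n} (P : A → Bool) (h : Fin (suc n) → A) x →
  (∀ j → P (h j) ≡ not ⌊ j ≟ᶠ x ⌋) → filterᵇ P (tabulate h) ≡ tabulate (h ∘ punchIn x)
filter-tabulate-punchIn {n = zero} P h fzero P≡ rewrite P≡ fzero = refl
filter-tabulate-punchIn {n = suc n} P h fzero P≡ rewrite P≡ fzero =
  filter-all (T? ∘ P) (tabulate⁺ (λ j → Equivalence.from T-≡ (P≡ (fsuc j))))
filter-tabulate-punchIn {n = suc n} P h (fsuc x) P≡ rewrite P≡ fzero =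
  cong (h fzero ∷_) (filter-tabulate-punchIn P (h ∘ fsuc) x
    (λ j → trans (P≡ (fsuc j)) (cong not (does-≟-suc j x))))

toℕ-punchOut-< : ∀ {n} {i j : Fin (suc n)} (i≢j : i ≢ j) → toℕ j < toℕ i →
                 toℕ (punchOut i≢j) ≡ toℕ j
toℕ-punchOut-< {suc n} {fsuc i} {fzero}  _   _         = refl
toℕ-punchOut-< {suc n} {fsuc i} {fsuc j} i≢j (s≤s j<i) =
  cong suc (toℕ-punchOut-< (i≢j ∘ cong fsuc) j<i)

toℕ-punchOut-> : ∀ {n} {i j : Fin (suc n)} (i≢j : i ≢ j) → toℕ i < toℕ j →
                 suc (toℕ (punchOut i≢j)) ≡ toℕ j
toℕ-punchOut-> {_}     {fzero}  {fsuc j} _   _         = refl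
toℕ-punchOut-> {suc n} {fsuc i} {fsuc j} i≢j (s≤s i<j) =
  cong suc (toℕ-punchOut-> (i≢j ∘ cong fsuc) i<j)

[m%d+n]%d≡[m+n]%d : ∀ m n d .{{_ : NonZero d}} → (m % d + n) % d ≡ (m + n) % d
[m%d+n]%d≡[m+n]%d m n d = begin
  (m % d + n) % d          ≡⟨ %-distribˡ-+ (m % d) n d ⟩
  (m % d % d + n % d) % d  ≡⟨ cong (λ k → (k + n % d) % d) (m%n%n≡m%n m d) ⟩
  (m % d + n % d) % d      ≡⟨ %-distribˡ-+ m n d ⟨
  (m + n) % d              ∎
  where open ≡-Reasoning

[m+n%d]%d≡[m+n]%d : ∀ m n d .{{_ : NonZero d}} → (m + n % d) % d ≡ (m + n) % d
[m+n%d]%d≡[m+n]%d m n d = begin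
  (m + n % d) % d  ≡⟨ cong (_% d) (+-comm m (n % d)) ⟩
  (n % d + m) % d  ≡⟨ [m%d+n]%d≡[m+n]%d n m d ⟩
  (n + m) % d      ≡⟨ cong (_% d) (+-comm n m) ⟩
  (m + n) % d      ∎
  where open ≡-Reasoning

IsRound : ℕ → ℕ → Set
IsRound M r = 1 ≤ r × r ≤ M

module Cyclic (M : ℕ) .{{_ : NonZero M}} where

  cyclic : ℕ → ℕ
  cyclic x = suc ((x ∸ 1) % M)

  distance : ℕ → ℕ → ℕ
  distance a r = (r + M ∸ a) % M

  cyclic-isRound : ∀ x → IsRound M (cyclic x)
  cyclic-isRound x = s≤s z≤n , m%n<n (x ∸ 1) M

  cyclic-id : ∀ {r} → IsRound M r → cyclic r ≡ r
  cyclic-id {suc r} (_ , r<M) = cong suc (m<n⇒m%n≡m r<M)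

  cyclic-+M : ∀ {x} → 1 ≤ x → cyclic (x + M) ≡ cyclic x
  cyclic-+M {suc x} _ = cong suc ([m+n]%n≡m%n x M)

  cyclic-cyclic : ∀ {x} j → 1 ≤ x → cyclic (cyclic x + j) ≡ cyclic (x + j)
  cyclic-cyclic {suc x} j _ = cong suc ([m%d+n]%d≡[m+n]%d x j M)

  prevRound-cyclic : ∀ {a} j → 1 ≤ a → prevRound (suc M) (cyclic (a + suc j)) ≡ cyclic (a + j)
  prevRound-cyclic {suc a} j _ rewrite +-suc a j with suc (a + j) % M in eq
  ... | zero = begin
    M                  ≡⟨ m+[n∸m]≡n {1} {M} (>-nonZero⁻¹ M) ⟨
    suc (M ∸ 1)        ≡⟨ cong suc (%-pred-≡0 eq) ⟨
    suc ((a + j) % M)  ∎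
    where open ≡-Reasoning
  ... | suc k = cong suc (≤-antisym
          (m<[1+n%d]⇒m≤[n%d] (a + j) M (≤-reflexive (sym eq)))
          ([1+m%d]≤1+n⇒[m%d]≤n (a + j) k M (subst (0 <_) (sym eq) (s≤s z≤n)) (≤-reflexive eq)))

  distance-< : ∀ a r → distance a r < M
  distance-< a r = m%n<n (r + M ∸ a) M

  cyclic-distance : ∀ {a r} → IsRound M a → IsRound M r → cyclic (a + distance a r) ≡ r
  cyclic-distance {suc a} {suc r} (_ , a<M) (_ , r<M) = cong suc (begin
    (a + (r + M ∸ a) % M) % M  ≡⟨ [m+n%d]%d≡[m+n]%d a (r + M ∸ a) M ⟩
    (a + (r + M ∸ a)) % M      ≡⟨ cong (_% M) (m+[n∸m]≡n (≤-trans (<⇒≤ a<M) (m≤n+m M r))) ⟩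
    (r + M) % M                ≡⟨ [m+n]%n≡m%n r M ⟩
    r % M                      ≡⟨ m<n⇒m%n≡m r<M ⟩
    r                          ∎)
    where open ≡-Reasoning

  distance-cyclic : ∀ {a j} → IsRound M a → j < M → distance a (cyclic (a + j)) ≡ j
  distance-cyclic {suc a} {j} (_ , a<M) j<M = begin
    ((a + j) % M + M ∸ a) % M    ≡⟨ cong (_% M) (+-∸-assoc ((a + j) % M) (<⇒≤ a<M)) ⟩
    ((a + j) % M + (M ∸ a)) % M  ≡⟨ [m%d+n]%d≡[m+n]%d (a + j) (M ∸ a) M ⟩
    (a + j + (M ∸ a)) % M        ≡⟨ cong (_% M) (+-assoc a j (M ∸ a)) ⟩
    (a + (j + (M ∸ a))) % M      ≡⟨ cong (λ k → (a + k) % M) (+-comm j (M ∸ a)) ⟩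
    (a + ((M ∸ a) + j)) % M      ≡⟨ cong (_% M) (+-assoc a (M ∸ a) j) ⟨
    (a + (M ∸ a) + j) % M        ≡⟨ cong (λ k → (k + j) % M) (m+[n∸m]≡n (<⇒≤ a<M)) ⟩
    (M + j) % M                  ≡⟨ cong (_% M) (+-comm M j) ⟩
    (j + M) % M                  ≡⟨ [m+n]%n≡m%n j M ⟩
    j % M                        ≡⟨ m<n⇒m%n≡m j<M ⟩
    j                            ∎
    where open ≡-Reasoning

  cyclic-injective : ∀ {a j k} → IsRound M a → j < M → k < M → cyclic (a + j) ≡ cyclic (a + k) → j ≡ k
  cyclic-injective {a} {j} {k} a∈ j<M k<M eq = begin
    j                            ≡⟨ distance-cyclic a∈ j<M ⟨
    distance a (cyclic (a + j))  ≡⟨ cong (distance a) eq ⟩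
    distance a (cyclic (a + k))  ≡⟨ distance-cyclic a∈ k<M ⟩
    k                            ∎
    where open ≡-Reasoning

  distance-injective : ∀ {a r₁ r₂} → IsRound M a → IsRound M r₁ → IsRound M r₂ →
                       distance a r₁ ≡ distance a r₂ → r₁ ≡ r₂
  distance-injective {a} {r₁} {r₂} a∈ r₁∈ r₂∈ eq = begin
    r₁                          ≡⟨ cyclic-distance a∈ r₁∈ ⟨
    cyclic (a + distance a r₁)  ≡⟨ cong (λ d → cyclic (a + d)) eq ⟩
    cyclic (a + distance a r₂)  ≡⟨ cyclic-distance a∈ r₂∈ ⟩
    r₂                          ∎
    where open ≡-Reasoning

diffs : List ℕ → List ℕ
diffs (x ∷ y ∷ ys) = (y ∸ x) ∷ diffs (y ∷ ys)
diffs _            = []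

diffs-++ : ∀ xs y ys → diffs (xs ++ y ∷ ys) ≡ diffs (xs ++ y ∷ []) ++ diffs (y ∷ ys)
diffs-++ []           y ys = refl
diffs-++ (x ∷ [])     y ys = refl
diffs-++ (x ∷ z ∷ xs) y ys = cong ((z ∸ x) ∷_) (diffs-++ (z ∷ xs) y ys)

diffs-map-+ : ∀ c xs → diffs (map (_+ c) xs) ≡ diffs xs
diffs-map-+ c []           = refl
diffs-map-+ c (x ∷ [])     = refl
diffs-map-+ c (x ∷ y ∷ xs) =
  cong₂ _∷_ (trans (cong₂ _∸_ (+-comm y c) (+-comm x c)) ([m+n]∸[m+o]≡n∸o c y x))
            (diffs-map-+ c (y ∷ xs))

sum-diffs : ∀ {x xs y} → Linked _≤_ (x ∷ xs) → All (_≤ y) (x ∷ xs) →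
            x + sum (diffs (x ∷ xs ++ y ∷ [])) ≡ y
sum-diffs {x} {[]} {y} _ (x≤y ∷ []) = trans (cong (x +_) (+-identityʳ (y ∸ x))) (m+[n∸m]≡n x≤y)
sum-diffs {x} {z ∷ zs} {y} (x≤z ∷ sorted) (_ ∷ bounded) = begin
  x + ((z ∸ x) + S)  ≡⟨ +-assoc x (z ∸ x) S ⟨
  x + (z ∸ x) + S    ≡⟨ cong (_+ S) (m+[n∸m]≡n x≤z) ⟩
  z + S              ≡⟨ sum-diffs sorted bounded ⟩
  y                  ∎
  where
  open ≡-Reasoning
  S : ℕ
  S = sum (diffs (z ∷ zs ++ y ∷ []))

cyclicDiffs≡diffs : ∀ M r rs → cyclicDiffs (suc M) (r ∷ rs) ≡ diffs (r ∷ rs ++ r + M ∷ [])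
cyclicDiffs≡diffs M r rs = go r rs
  where
  go : ∀ x xs → dseqAux (suc M) r (x ∷ xs) ≡ diffs (x ∷ xs ++ r + M ∷ [])
  go x []       = refl
  go x (y ∷ xs) = cong ((y ∸ x) ∷_) (go y xs)

IsInfix : List ℕ → List ℕ → Set
IsInfix p xs = ∃₂ λ P Q → xs ≡ P ++ p ++ Q

rotation-sum : ∀ {d e} → Rotation d e → sum e ≡ sum d
rotation-sum (as , bs , refl , refl) =
  trans (sum-++ bs as) (trans (+-comm (sum bs) (sum as)) (sym (sum-++ as bs)))

rotation-infix-doubled : ∀ {d e p ys} → Rotation d e → e ≡ p ++ ys → IsInfix p (d ++ d)
rotation-infix-doubled {p = p} {ys} (as , bs , refl , e≡bs++as) e≡p++ys = as , ys ++ bs , (begin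
  (as ++ bs) ++ as ++ bs  ≡⟨ ++-assoc as bs (as ++ bs) ⟩
  as ++ bs ++ as ++ bs    ≡⟨ cong (as ++_) (++-assoc bs as bs) ⟨
  as ++ (bs ++ as) ++ bs  ≡⟨ cong (λ e → as ++ e ++ bs) (trans (sym e≡bs++as) e≡p++ys) ⟩
  as ++ (p ++ ys) ++ bs   ≡⟨ cong (as ++_) (++-assoc p ys bs) ⟩
  as ++ p ++ ys ++ bs     ∎)
  where open ≡-Reasoning

reverse-infix : ∀ {p xs} → reverse p ≡ p → IsInfix p (reverse xs) → IsInfix p xs
reverse-infix {p} {xs} palindrome (P , Q , eq) = reverse Q , reverse P , (begin
  xs                                     ≡⟨ reverse-involutive xs ⟨
  reverse (reverse xs)                   ≡⟨ cong reverse eq ⟩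
  reverse (P ++ p ++ Q)                  ≡⟨ reverse-++ P (p ++ Q) ⟩
  reverse (p ++ Q) ++ reverse P          ≡⟨ cong (_++ reverse P) (reverse-++ p Q) ⟩
  (reverse Q ++ reverse p) ++ reverse P  ≡⟨ ++-assoc (reverse Q) (reverse p) (reverse P) ⟩
  reverse Q ++ reverse p ++ reverse P    ≡⟨ cong (λ q → reverse Q ++ q ++ reverse P) palindrome ⟩
  reverse Q ++ p ++ reverse P            ∎)
  where open ≡-Reasoning

prefix-sum-≤ : ∀ p ys → sum p ≤ sum (p ++ ys)
prefix-sum-≤ p ys = ≤-trans (m≤m+n (sum p) (sum ys)) (≤-reflexive (sym (sum-++ p ys)))

contains-palindrome : ∀ {p d} → reverse p ≡ p → ContainsUpToSymmetry p d →
                      sum p ≤ sum d × IsInfix p (d ++ d)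
contains-palindrome {p} {d} _ (_ , inj₁ rot , ys , refl) =
  subst (sum p ≤_) (rotation-sum rot) (prefix-sum-≤ p ys) , rotation-infix-doubled rot refl
contains-palindrome {p} {d} palindrome (_ , inj₂ rot , ys , refl) =
  subst (sum p ≤_) (trans (rotation-sum rot) (sum-↭ (↭-reverse d))) (prefix-sum-≤ p ys) ,
  reverse-infix palindrome (subst (IsInfix p) (sym (reverse-++ d d)) (rotation-infix-doubled rot refl))

no-2222-in-[] : ¬ ContainsUpToSymmetry (2 ∷ 2 ∷ 2 ∷ 2 ∷ []) []
no-2222-in-[] contains with () ← proj₁ (contains-palindrome refl contains)

m∸n≡1+o⇒m≡n+1+o : ∀ m n {o} → m ∸ n ≡ suc o → m ≡ n + suc o
m∸n≡1+o⇒m≡n+1+o m       zero    eq = eq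
m∸n≡1+o⇒m≡n+1+o (suc m) (suc n) eq = cong suc (m∸n≡1+o⇒m≡n+1+o m n eq)

suffix-with-diffs : ∀ {x xs} P R → diffs (x ∷ xs) ≡ P ++ R →
  ∃₂ λ y ys → y ∈ x ∷ xs × (∀ {z} → z ∈ y ∷ ys → z ∈ x ∷ xs) × diffs (y ∷ ys) ≡ R
suffix-with-diffs {x} {xs} [] R eq = x , xs , here refl , (λ z∈ → z∈) , eq
suffix-with-diffs {x} {z ∷ zs} (_ ∷ P) R eq with suffix-with-diffs P R (proj₂ (∷-injective eq))
... | y , ys , y∈ , sub , eq′ = y , ys , there y∈ , there ∘ sub , eq′

run-of-2s : ∀ k {x xs Q} → diffs (x ∷ xs) ≡ replicate k 2 ++ Q → ∀ {t} → t ≤ k → x + 2 * t ∈ x ∷ xs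
run-of-2s k       {x}          _  {zero}  _         = here (+-identityʳ x)
run-of-2s (suc k) {x} {y ∷ ys} eq {suc t} (s≤s t≤k) with ∷-injective eq
... | y∸x≡2 , eq′ = there (subst (_∈ y ∷ ys) y+2t≡x+2[1+t] (run-of-2s k eq′ t≤k))
  where
  y+2t≡x+2[1+t] : y + 2 * t ≡ x + 2 * suc t
  y+2t≡x+2[1+t] = begin
    y + 2 * t        ≡⟨ cong (_+ 2 * t) (m∸n≡1+o⇒m≡n+1+o y x y∸x≡2) ⟩
    x + 2 + 2 * t    ≡⟨ +-assoc x 2 (2 * t) ⟩
    x + (2 + 2 * t)  ≡⟨ cong (x +_) (*-suc 2 t) ⟨
    x + 2 * suc t    ∎
    where open ≡-Reasoning

module CyclicRuns (M : ℕ) .{{_ : NonZero M}} where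
  open Cyclic M

  -- The D-sequence read twice is the difference list of the break rounds over two laps, so a
  -- run of 2s in some rotation of the D-sequence becomes an ordinary run in that list.
  oneLap twoLaps : ℕ → List ℕ → List ℕ
  oneLap r rs = r ∷ rs ++ r + M ∷ []
  twoLaps r rs = r ∷ rs ++ map (_+ M) (oneLap r rs)

  diffs-twoLaps : ∀ r rs → diffs (twoLaps r rs) ≡ diffs (oneLap r rs) ++ diffs (oneLap r rs)
  diffs-twoLaps r rs = trans (diffs-++ (r ∷ rs) (r + M) (map (_+ M) (rs ++ r + M ∷ [])))
                             (cong (diffs (oneLap r rs) ++_) (diffs-map-+ M (oneLap r rs)))

  module _ {r rs} (rounds∈ : ∀ {x} → x ∈ r ∷ rs → IsRound M x) where

    cyclic-∈ : ∀ {x} → x ∈ r ∷ rs → cyclic x ∈ r ∷ rs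
    cyclic-∈ x∈ = subst (_∈ r ∷ rs) (sym (cyclic-id (rounds∈ x∈))) x∈

    twoLaps-∈ : ∀ {z} → z ∈ twoLaps r rs → 1 ≤ z × cyclic z ∈ r ∷ rs
    twoLaps-∈ z∈ with ∈-++⁻ (r ∷ rs) z∈
    ... | inj₁ z∈L = proj₁ (rounds∈ z∈L) , cyclic-∈ z∈L
    ... | inj₂ z∈L+M with ∈-map⁻ (_+ M) z∈L+M
    ...   | y , y∈ , refl with ∈-++⁻ (r ∷ rs) y∈
    ...     | inj₁ y∈L = ≤-trans (proj₁ (rounds∈ y∈L)) (m≤m+n y M) ,
                          subst (_∈ r ∷ rs) (sym (cyclic-+M (proj₁ (rounds∈ y∈L)))) (cyclic-∈ y∈L)
    ...     | inj₂ (here refl) = ≤-trans 1≤r (≤-trans (m≤m+n r M) (m≤m+n (r + M) M)) ,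
                          subst (_∈ r ∷ rs)
                                (sym (trans (cyclic-+M (≤-trans 1≤r (m≤m+n r M))) (cyclic-+M 1≤r)))
                                (cyclic-∈ (here refl))
      where
      1≤r : 1 ≤ r
      1≤r = proj₁ (rounds∈ (here refl))

  run-of-five-breaks : ∀ {L} → Linked _≤_ L → (∀ {x} → x ∈ L → IsRound M x) →
    ContainsUpToSymmetry (2 ∷ 2 ∷ 2 ∷ 2 ∷ []) (cyclicDiffs (suc M) L) →
    8 ≤ M × ∃ λ a → IsRound M a × (∀ {t} → t ≤ 4 → cyclic (a + 2 * t) ∈ L)
  run-of-five-breaks {[]} _ _ contains = contradiction contains no-2222-in-[]
  run-of-five-breaks {r ∷ rs} sorted rounds∈ contains
    with contains-palindrome refl (subst (ContainsUpToSymmetry _) (cyclicDiffs≡diffs M r rs) contains)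
  ... | 8≤sum , P , Q , eq with suffix-with-diffs P _ (trans (diffs-twoLaps r rs) eq)
  ...   | y , ys , y∈ , sub , eq′ = subst (8 ≤_) sum≡M 8≤sum , cyclic y , cyclic-isRound y , run
    where
    sum≡M : sum (diffs (oneLap r rs)) ≡ M
    sum≡M = +-cancelˡ-≡ r _ _
      (sum-diffs sorted (All.tabulate (λ x∈ → ≤-trans (proj₂ (rounds∈ x∈)) (m≤n+m M r))))
    run : ∀ {t} → t ≤ 4 → cyclic (cyclic y + 2 * t) ∈ r ∷ rs
    run {t} t≤4 = subst (_∈ r ∷ rs) (sym (cyclic-cyclic (2 * t) (proj₁ (twoLaps-∈ rounds∈ y∈))))
                        (proj₂ (twoLaps-∈ rounds∈ (sub (run-of-2s 4 eq′ t≤4))))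

∈-rounds : ∀ {M r} → IsRound M r → r ∈ rounds (suc M)
∈-rounds {r = suc r} (_ , r<M) = ∈-applyUpTo⁺ suc r<M

∈-opponents : ∀ {n} {x y : Fin n} → y ≢ x → y ∈ opponents x
∈-opponents {n} {x} {y} y≢x =
  ∈-filter⁺ (λ j → T? (not ⌊ j ≟ᶠ x ⌋)) (∈-allFin {n = n} y) (kept (y ≟ᶠ x))
  where
  kept : ∀ d → T (not ⌊ d ⌋)
  kept (yes y≡x) = y≢x y≡x
  kept (no _)    = tt

∈-opponents⁻ : ∀ {n} {x y : Fin n} → y ∈ opponents x → y ≢ x
∈-opponents⁻ {n} {x} {y} y∈ y≡x =
  dropped (y ≟ᶠ x) (proj₂ (∈-filter⁻ (λ j → T? (not ⌊ j ≟ᶠ x ⌋)) {xs = allFin n} y∈))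
  where
  dropped : ∀ d → T (not ⌊ d ⌋) → ⊥
  dropped (no y≢x) _ = y≢x y≡x

firstVenue-unique : ∀ {n} (s : Schedule n) x y {js} → y ∈ js →
  (∀ {j} → j ∈ js → rnd s x j ≡ rnd s x y → j ≡ y) → firstVenue s x (rnd s x y) js ≡ home s x y
firstVenue-unique s x y {j ∷ js} y∈ unique with rnd s x j ≡ᵇ rnd s x y in eq
... | true =
  cong (home s x) (unique (here refl) (≡ᵇ⇒≡ (rnd s x j) (rnd s x y) (Equivalence.from T-≡ eq)))
... | false with y∈
...   | here refl = contradiction (≡⇒≡ᵇ (rnd s x y) (rnd s x y) refl) (subst T eq)
...   | there y∈js = firstVenue-unique s x y y∈js (unique ∘ there)

rankingHAP-tabulate : ∀ {n} (s : Schedule (suc n)) x →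
                      rankingHAP s x ≡ tabulate (home s x ∘ punchIn x)
rankingHAP-tabulate s x =
  trans (cong (map (home s x)) (filter-tabulate-punchIn _ (λ j → j) x (λ _ → refl)))
        (map-tabulate (punchIn x) (home s x))

breakRounds-sorted : ∀ {M} (s : Schedule (suc M)) → Linked _≤_ (breakRounds s)
breakRounds-sorted {M} s = filter⁺ _ ≤-trans (applyUpTo⁺₂ suc M (λ i → n≤1+n (suc i)))

∈-breakRounds⁻ : ∀ {M} (s : Schedule (suc M)) {r} → r ∈ breakRounds s →
                 IsRound M r × ∃ λ z → breakAt s z r ≡ true
∈-breakRounds⁻ {M} s r∈
  with ∈-filter⁻ (T? ∘ λ r → any (λ i → breakAt s i r) (allFin (suc M))) {xs = applyUpTo suc M} r∈
... | r∈rounds , some-break with ∈-applyUpTo⁻ suc r∈rounds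
...   | i , i<M , refl = (s≤s z≤n , i<M) ,
        map₂ (Equivalence.to T-≡) (satisfied (any⁻ _ (allFin (suc M)) some-break))

module FeasibleSchedule {M : ℕ} (s : Schedule (suc M)) (feasible : Feasible s) where

  Team : Set
  Team = Fin (suc M)

  rnd-comm : ∀ {x y : Team} → x ≢ y → rnd s x y ≡ rnd s y x
  rnd-comm x≢y = proj₁ (proj₁ feasible _ _ x≢y)

  home-flip : ∀ {x y : Team} → x ≢ y → home s y x ≡ not (home s x y)
  home-flip x≢y = proj₁ (proj₂ (proj₁ feasible _ _ (x≢y ∘ sym)))

  rnd-isRound : ∀ {x y : Team} → x ≢ y → IsRound M (rnd s x y)
  rnd-isRound x≢y = proj₂ (proj₂ (proj₁ feasible _ _ x≢y))

  opponent : Team → ∀ {r} → IsRound M r → Team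
  opponent x (1≤r , r≤M) = proj₁ (proj₂ feasible x _ 1≤r r≤M)

  opponent-≢ : ∀ x {r} (r∈ : IsRound M r) → opponent x r∈ ≢ x
  opponent-≢ x (1≤r , r≤M) = proj₁ (proj₂ (proj₂ feasible x _ 1≤r r≤M))

  rnd-opponent : ∀ x {r} (r∈ : IsRound M r) → rnd s x (opponent x r∈) ≡ r
  rnd-opponent x (1≤r , r≤M) = proj₁ (proj₂ (proj₂ (proj₂ feasible x _ 1≤r r≤M)))

  opponent-unique : ∀ x {r} (r∈ : IsRound M r) {z} → z ≢ x → rnd s x z ≡ r → z ≡ opponent x r∈
  opponent-unique x (1≤r , r≤M) {z} = proj₂ (proj₂ (proj₂ (proj₂ feasible x _ 1≤r r≤M))) z

  rnd-injective : ∀ {x y y′ : Team} → y ≢ x → y′ ≢ x → rnd s x y ≡ rnd s x y′ → y ≡ y′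
  rnd-injective {x} {y} {y′} y≢x y′≢x eq =
    trans (opponent-unique x r∈ y≢x refl) (sym (opponent-unique x r∈ y′≢x (sym eq)))
    where
    r∈ : IsRound M (rnd s x y)
    r∈ = rnd-isRound (y≢x ∘ sym)

  venue-rnd : ∀ {x y : Team} → y ≢ x → venue s x (rnd s x y) ≡ home s x y
  venue-rnd {x} {y} y≢x = firstVenue-unique s x y (∈-opponents y≢x)
    (λ j∈ eq → rnd-injective (∈-opponents⁻ j∈) y≢x eq)

  venue-opponent : ∀ x {r} (r∈ : IsRound M r) → venue s x r ≡ home s x (opponent x r∈)
  venue-opponent x r∈ = trans (cong (venue s x) (sym (rnd-opponent x r∈))) (venue-rnd (opponent-≢ x r∈))

  opponent-involutive : ∀ x {r} (r∈ : IsRound M r) → opponent (opponent x r∈) r∈ ≡ x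
  opponent-involutive x r∈ = rnd-injective (opponent-≢ y r∈) (opponent-≢ x r∈ ∘ sym)
    (trans (rnd-opponent y r∈) (trans (sym (rnd-opponent x r∈)) (rnd-comm (opponent-≢ x r∈ ∘ sym))))
    where
    y : Team
    y = opponent x r∈

  venue-opponent-flip : ∀ x {r} (r∈ : IsRound M r) → venue s (opponent x r∈) r ≡ not (venue s x r)
  venue-opponent-flip x {r} r∈ = begin
    venue s y r               ≡⟨ venue-opponent y r∈ ⟩
    home s y (opponent y r∈)  ≡⟨ cong (home s y) (opponent-involutive x r∈) ⟩
    home s y x                ≡⟨ home-flip (opponent-≢ x r∈ ∘ sym) ⟩
    not (home s x y)          ≡⟨ cong not (venue-opponent x r∈) ⟨
    not (venue s x r)         ∎
    where
    open ≡-Reasoning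
    y : Team
    y = opponent x r∈

  home-count : ℕ → ℕ
  home-count r = ∑[ x < suc M ] bit (venue s x r)

  home-count-half : ∀ {r} → IsRound M r → home-count r + home-count r ≡ suc M
  home-count-half {r} r∈ = begin
    home-count r + home-count r                                ≡⟨ cong (_+ home-count r) by-opponents ⟩
    ∑[ x < suc M ] bit (not (venue s x r)) + home-count r      ≡⟨ ∑-complement (λ x → venue s x r) ⟩
    suc M                                                      ∎
    where
    open ≡-Reasoning
    flip : Team → Team
    flip x = opponent x r∈
    by-opponents : home-count r ≡ ∑[ x < suc M ] bit (not (venue s x r))
    by-opponents = trans
      (sum-permute (λ x → bit (venue s x r))
                   (permutation flip flip (λ x → opponent-involutive x r∈) (λ x → opponent-involutive x r∈)))
      (sum-cong-≗ (λ x → cong bit (venue-opponent-flip x r∈)))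

  prevRound-isRound : ∀ {w} → IsRound M w → IsRound M (prevRound (suc M) w)
  prevRound-isRound {suc zero}    (_ , 1≤M) = 1≤M , ≤-refl
  prevRound-isRound {suc (suc w)} (_ , w<M) = s≤s z≤n , ≤-trans (n≤1+n (suc w)) w<M

  HomeBreak : Team → ℕ → Set
  HomeBreak x w = venue s x (prevRound (suc M) w) ≡ true × venue s x w ≡ true

  -- Consecutive rounds have equally many home teams, so if z plays away twice some team
  -- plays at home twice.
  hh-break : ∀ {w} → IsRound M w → ∀ z → breakAt s z w ≡ true → ∃ λ x → HomeBreak x w
  hh-break {w} w∈ z z-breaks with venue s z w in z-venue
  ... | true  = z , ==ᴮ⇒≡ z-breaks , z-venue
  ... | false = map₂ bit+bit≥2 (pigeonhole both z z-away (≤-reflexive (sym ∑-both)))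
    where
    v : ℕ
    v = prevRound (suc M) w
    both : Team → ℕ
    both x = bit (venue s x v) + bit (venue s x w)
    ∑-both : ∑[ x < suc M ] both x ≡ suc M
    ∑-both = trans (∑-distrib-+ (λ x → bit (venue s x v)) (λ x → bit (venue s x w)))
      (trans (cong (_+ home-count w) (+-self-injective {home-count v} {home-count w}
                (trans (home-count-half (prevRound-isRound w∈)) (sym (home-count-half w∈)))))
             (home-count-half w∈))
    z-away : both z ≡ 0
    z-away = cong₂ _+_ (cong bit (==ᴮ⇒≡ z-breaks)) (cong bit z-venue)

  EvenRankHome : Team → Set
  EvenRankHome x = ∀ k → home s x (punchIn x k) ≡ even (toℕ k)

  module _ {x} (x-home : EvenRankHome x) {y} (x≢y : x ≢ y) where

    home-by-rank : home s x y ≡ even (toℕ (punchOut x≢y))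
    home-by-rank = trans (cong (home s x) (sym (punchIn-punchOut x≢y))) (x-home _)

    home-vs-stronger : toℕ y < toℕ x → home s x y ≡ even (toℕ y)
    home-vs-stronger y<x = trans home-by-rank (cong even (toℕ-punchOut-< x≢y y<x))

    home-vs-weaker : toℕ x < toℕ y → home s x y ≡ not (even (toℕ y))
    home-vs-weaker x<y = begin
      home s x y          ≡⟨ home-by-rank ⟩
      even k              ≡⟨ not-involutive (even k) ⟨
      not (not (even k))  ≡⟨ cong not (even-suc k) ⟨
      not (even (suc k))  ≡⟨ cong (not ∘ even) (toℕ-punchOut-> x≢y x<y) ⟩
      not (even (toℕ y))  ∎
      where
      open ≡-Reasoning
      k : ℕ
      k = toℕ (punchOut x≢y)

  same-parity-< : ∀ {u v} → EvenRankHome u → EvenRankHome v → u ≢ v → toℕ u < toℕ v →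
                  even (toℕ u) ≡ even (toℕ v)
  same-parity-< {u} {v} u-home v-home u≢v u<v = begin
    even (toℕ u)              ≡⟨ home-vs-stronger v-home (u≢v ∘ sym) u<v ⟨
    home s v u                ≡⟨ home-flip u≢v ⟩
    not (home s u v)          ≡⟨ cong not (home-vs-weaker u-home u≢v u<v) ⟩
    not (not (even (toℕ v)))  ≡⟨ not-involutive _ ⟩
    even (toℕ v)              ∎
    where open ≡-Reasoning

  same-parity : ∀ {u v} → EvenRankHome u → EvenRankHome v → u ≢ v → even (toℕ u) ≡ even (toℕ v)
  same-parity {u} {v} u-home v-home u≢v with <-cmp (toℕ u) (toℕ v)
  ... | tri< u<v _ _ = same-parity-< u-home v-home u≢v u<v
  ... | tri≈ _ u≡v _ = contradiction (toℕ-injective u≡v) u≢v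
  ... | tri> _ _ v<u = sym (same-parity-< v-home u-home (u≢v ∘ sym) v<u)

  home-transitive : ∀ {u v w} → EvenRankHome u → EvenRankHome v → EvenRankHome w →
                    u ≢ v → v ≢ w → u ≢ w → home s u v ≡ home s v w → home s u w ≡ home s u v
  home-transitive {u} {v} {w} u-home v-home w-home u≢v v≢w u≢w uv≡vw
    with <-cmp (toℕ u) (toℕ v) | <-cmp (toℕ v) (toℕ w)
  ... | tri≈ _ u≡v _ | _ = contradiction (toℕ-injective u≡v) u≢v
  ... | _ | tri≈ _ v≡w _ = contradiction (toℕ-injective v≡w) v≢w
  ... | tri< u<v _ _ | tri< v<w _ _ = begin
    home s u w          ≡⟨ home-vs-weaker u-home u≢w (<-trans u<v v<w) ⟩
    not (even (toℕ w))  ≡⟨ cong not (same-parity v-home w-home v≢w) ⟨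
    not (even (toℕ v))  ≡⟨ home-vs-weaker u-home u≢v u<v ⟨
    home s u v          ∎
    where open ≡-Reasoning
  ... | tri> _ _ v<u | tri> _ _ w<v = begin
    home s u w    ≡⟨ home-vs-stronger u-home u≢w (<-trans w<v v<u) ⟩
    even (toℕ w)  ≡⟨ same-parity v-home w-home v≢w ⟨
    even (toℕ v)  ≡⟨ home-vs-stronger u-home u≢v v<u ⟨
    home s u v    ∎
    where open ≡-Reasoning
  ... | tri< u<v _ _ | tri> _ _ w<v = contradiction (begin
    not (even (toℕ v))  ≡⟨ home-vs-weaker u-home u≢v u<v ⟨
    home s u v          ≡⟨ uv≡vw ⟩
    home s v w          ≡⟨ home-vs-stronger v-home v≢w w<v ⟩
    even (toℕ w)        ≡⟨ same-parity v-home w-home v≢w ⟨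
    even (toℕ v)        ∎) (not-¬ refl ∘ sym)
    where open ≡-Reasoning
  ... | tri> _ _ v<u | tri< v<w _ _ = contradiction (begin
    even (toℕ v)        ≡⟨ home-vs-stronger u-home u≢v v<u ⟨
    home s u v          ≡⟨ uv≡vw ⟩
    home s v w          ≡⟨ home-vs-weaker v-home v≢w v<w ⟩
    not (even (toℕ w))  ≡⟨ cong not (same-parity v-home w-home v≢w) ⟨
    not (even (toℕ v))  ∎) (not-¬ refl)
    where open ≡-Reasoning

  module _ .{{_ : NonZero M}} where
    open Cyclic M

    home-games-by-round : ∀ x {w} → IsRound M w →
      ∑[ k < M ] bit (home s x (punchIn x k)) ≡ ∑[ j < M ] bit (venue s x (cyclic (w + toℕ j)))
    home-games-by-round x {w} w∈ =
      trans (sum-permute (λ k → bit (home s x (punchIn x k)))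
                         (permutation rank position rank-position position-rank))
            (sum-cong-≗ home-at-rank)
      where
      opp : Fin M → Team
      opp j = opponent x (cyclic-isRound (w + toℕ j))
      rank : Fin M → Fin M
      rank j = punchOut (opponent-≢ x (cyclic-isRound (w + toℕ j)) ∘ sym)
      home-at-rank : ∀ j → bit (home s x (punchIn x (rank j))) ≡ bit (venue s x (cyclic (w + toℕ j)))
      home-at-rank j = cong bit (trans (cong (home s x) (punchIn-punchOut _))
                                       (sym (venue-opponent x (cyclic-isRound (w + toℕ j)))))
      position : Fin M → Fin M
      position k = fromℕ< (distance-< w (rnd s x (punchIn x k)))
      opp-position : ∀ k → punchIn x k ≡ opp (position k)
      opp-position k = opponent-unique x (cyclic-isRound (w + toℕ (position k))) (punchInᵢ≢i x k)
        (sym (begin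
          cyclic (w + toℕ (position k))                    ≡⟨ cong (λ d → cyclic (w + d)) (toℕ-fromℕ< _) ⟩
          cyclic (w + distance w (rnd s x (punchIn x k)))  ≡⟨ cyclic-distance w∈ r∈ ⟩
          rnd s x (punchIn x k)                            ∎))
        where
        open ≡-Reasoning
        r∈ : IsRound M (rnd s x (punchIn x k))
        r∈ = rnd-isRound (punchInᵢ≢i x k ∘ sym)
      rank-position : ∀ k → rank (position k) ≡ k
      rank-position k = trans (punchOut-cong x (sym (opp-position k))) (punchOut-punchIn x)
      position-rank : ∀ j → position (rank j) ≡ j
      position-rank j = toℕ-injective (begin
        toℕ (position (rank j))                    ≡⟨ toℕ-fromℕ< _ ⟩
        distance w (rnd s x (punchIn x (rank j)))  ≡⟨ cong (distance w ∘ rnd s x) (punchIn-punchOut _) ⟩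
        distance w (rnd s x (opp j))               ≡⟨ cong (distance w) (rnd-opponent x _) ⟩
        distance w (cyclic (w + toℕ j))            ≡⟨ distance-cyclic w∈ (toℕ<n j) ⟩
        toℕ j                                      ∎)
        where open ≡-Reasoning

module SingleBreakSchedule {m : ℕ} (s : Schedule (suc (suc m))) (feasible : Feasible s)
                           (single-break : SingleBreak s) (m-even : even m ≡ true) where

  M : ℕ
  M = suc m

  open FeasibleSchedule s feasible
  open Cyclic M

  other-rounds-alternate : ∀ {x w r} → IsRound M w → IsRound M r → r ≢ w → breakAt s x w ≡ true →
                           venue s x (prevRound (suc M) r) ≢ venue s x r
  other-rounds-alternate {x} {w} {r} w∈ r∈ r≢w x-breaks with breakAt s x r in x-breaks-at-r
  ... | false = ==ᴮ⇒≢ x-breaks-at-r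
  ... | true  = contradiction (sym (single-break x))
                  (<⇒≢ (length-≥2 (break-listed x-breaks-at-r r∈) (break-listed x-breaks w∈) r≢w))
    where
    break-listed : ∀ {u} → breakAt s x u ≡ true → IsRound M u →
                   u ∈ filterᵇ (breakAt s x) (rounds (suc M))
    break-listed eq u∈ = ∈-filter⁺ (T? ∘ breakAt s x) (∈-rounds u∈) (Equivalence.from T-≡ eq)

  module _ {x a b} (a∈ : IsRound M a) (b<M : b < M) (b-even : even b ≡ true)
           (x-breaks : HomeBreak x (cyclic (a + b))) where

    private
      alternates : ∀ j → cyclic (a + suc j) ≢ cyclic (a + b) →
                   venue s x (cyclic (a + suc j)) ≢ venue s x (cyclic (a + j))
      alternates j other eq =
        other-rounds-alternate {x} (cyclic-isRound (a + b)) (cyclic-isRound (a + suc j)) other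
        (cong₂ _==ᴮ_ (proj₁ x-breaks) (proj₂ x-breaks))
        (trans (cong (venue s x) (prevRound-cyclic j (proj₁ a∈))) (sym eq))

      alternates-inside : ∀ j → suc j < M → suc j ≢ b →
                          venue s x (cyclic (a + suc j)) ≢ venue s x (cyclic (a + j))
      alternates-inside j j<M j≢b = alternates j (j≢b ∘ cyclic-injective a∈ j<M b<M)

    venue-after-break : ∀ {j} → b ≤ j → j < M → venue s x (cyclic (a + j)) ≡ even j
    venue-after-break = alternating-agree
      (λ j b≤j j<M → alternates-inside j j<M (<⇒≢ (s≤s b≤j) ∘ sym))
      even-suc (trans (proj₂ x-breaks) (sym b-even))

    -- The cyclic step from round a + m to round a is not x's break, and x is at home in
    -- round a + m because m is even.
    venue-before-break : ∀ {j} → j < b → venue s x (cyclic (a + j)) ≡ not (even j)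
    venue-before-break {j} j<b = alternating-agree
      (λ i _ i<b → alternates-inside i (<-trans i<b b<M) (<⇒≢ i<b))
      (λ i → cong not (even-suc i)) venue-at-a z≤n j<b
      where
      lap : cyclic (a + M) ≡ cyclic (a + 0)
      lap = trans (cyclic-+M (proj₁ a∈)) (cong cyclic (sym (+-identityʳ a)))
      wraps : cyclic (a + M) ≢ cyclic (a + b)
      wraps eq = <⇒≢ (≤-<-trans z≤n j<b) (cyclic-injective a∈ (s≤s z≤n) b<M (trans (sym lap) eq))
      venue-at-a : venue s x (cyclic (a + 0)) ≡ not (even 0)
      venue-at-a = trans (cong (venue s x) (sym lap))
        (trans (¬-not (alternates m wraps))
               (cong not (trans (venue-after-break (s≤s⁻¹ b<M) ≤-refl) m-even)))

  -- With M odd, starting the ranking HAP with A would give x equally many home and away games.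
  even-rank-home : RankingFair s → ∀ {x w} → IsRound M w → HomeBreak x w → EvenRankHome x
  even-rank-home ranking-fair {x} {w} w∈ x-breaks k =
    trans (alternating-tabulate g alternates k) (cong (_==ᴮ even (toℕ k)) starts-home)
    where
    g : Fin M → Bool
    g = home s x ∘ punchIn x
    alternates : Alternating (tabulate g)
    alternates = subst Alternating (rankingHAP-tabulate s x) (ranking-fair x)
    X : ℕ
    X = ∑[ j < M ] bit (even (toℕ j))
    home-games : ∑[ k < M ] bit (g k) ≡ X
    home-games = trans (home-games-by-round x w∈) (sum-cong-≗ (cong bit ∘ venue-by-round))
      where
      venue-by-round : ∀ (j : Fin M) → venue s x (cyclic (w + toℕ j)) ≡ even (toℕ j)
      venue-by-round j = venue-after-break {x} w∈ (s≤s z≤n) refl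
        (subst (HomeBreak x) (sym (trans (cong cyclic (+-identityʳ w)) (cyclic-id w∈))) x-breaks)
        z≤n (toℕ<n j)
    starts-home : g fzero ≡ true
    starts-home with g fzero in g0
    ... | true  = refl
    ... | false = contradiction
      (trans (sym (even-+-self X)) (trans (cong even X+X≡M) (trans (even-suc m) (cong not m-even)))) λ ()
      where
      away-games : ∑[ k < M ] bit (g k) ≡ ∑[ k < M ] bit (not (even (toℕ k)))
      away-games = sum-cong-≗ λ k →
        cong bit (trans (alternating-tabulate g alternates k) (cong (_==ᴮ even (toℕ k)) g0))
      X+X≡M : X + X ≡ M
      X+X≡M = trans (cong (_+ X) (trans (sym home-games) away-games)) (∑-complement {M} (even ∘ toℕ))

  module _ {a} (a∈ : IsRound M a) where

    breakers-distinct : ∀ {x y b₁ b₂} → b₁ < M → b₂ < M → b₁ ≢ b₂ →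
      HomeBreak x (cyclic (a + b₁)) → HomeBreak y (cyclic (a + b₂)) → x ≢ y
    breakers-distinct {x} {b₁ = b₁} {b₂} b₁<M b₂<M b₁≢b₂ x-breaks y-breaks refl =
      other-rounds-alternate {x} (cyclic-isRound (a + b₁)) (cyclic-isRound (a + b₂))
        (b₁≢b₂ ∘ sym ∘ cyclic-injective a∈ b₂<M b₁<M)
        (cong₂ _==ᴮ_ (proj₁ x-breaks) (proj₂ x-breaks))
        (trans (proj₁ y-breaks) (sym (proj₂ y-breaks)))

    meeting-window : ∀ {x y b₁ b₂} → b₁ < b₂ → b₂ < M → even b₁ ≡ true → even b₂ ≡ true → x ≢ y →
      HomeBreak x (cyclic (a + b₁)) → HomeBreak y (cyclic (a + b₂)) →
      let j = distance a (rnd s x y) in b₁ ≤ j × j < b₂ × home s x y ≡ even j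
    meeting-window {x} {y} {b₁} {b₂} b₁<b₂ b₂<M b₁-even b₂-even x≢y x-breaks y-breaks =
      after-x , before-y , trans (sym venue-x) (after x-breaks after-x)
      where
      b₁<M : b₁ < M
      b₁<M = <-trans b₁<b₂ b₂<M
      j : ℕ
      j = distance a (rnd s x y)
      j<M : j < M
      j<M = distance-< a (rnd s x y)
      after : HomeBreak x (cyclic (a + b₁)) → b₁ ≤ j → venue s x (cyclic (a + j)) ≡ even j
      after x-breaks b₁≤j = venue-after-break {x} a∈ b₁<M b₁-even x-breaks b₁≤j j<M
      meets : cyclic (a + j) ≡ rnd s x y
      meets = cyclic-distance a∈ (rnd-isRound x≢y)
      venue-x : venue s x (cyclic (a + j)) ≡ home s x y
      venue-x = trans (cong (venue s x) meets) (venue-rnd (x≢y ∘ sym))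
      venue-y : venue s y (cyclic (a + j)) ≡ not (home s x y)
      venue-y = trans (cong (venue s y) (trans meets (rnd-comm x≢y))) (trans (venue-rnd x≢y) (home-flip x≢y))
      opposite : ∀ {e} → venue s x (cyclic (a + j)) ≡ e → venue s y (cyclic (a + j)) ≡ e → ⊥
      opposite vx vy = not-¬ refl (trans (sym venue-x) (trans vx (trans (sym vy) venue-y)))
      after-x : b₁ ≤ j
      after-x with b₁ ≤? j
      ... | yes b₁≤j = b₁≤j
      ... | no  b₁≰j = ⊥-elim (opposite
        (venue-before-break {x} a∈ b₁<M b₁-even x-breaks (≰⇒> b₁≰j))
        (venue-before-break {y} a∈ b₂<M b₂-even y-breaks (<-trans (≰⇒> b₁≰j) b₁<b₂)))
      before-y : j < b₂
      before-y with b₂ ≤? j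
      ... | no  b₂≰j = ≰⇒> b₂≰j
      ... | yes b₂≤j = ⊥-elim (opposite
        (after x-breaks (≤-trans (<⇒≤ b₁<b₂) b₂≤j))
        (venue-after-break {y} a∈ b₂<M b₂-even y-breaks b₂≤j j<M))

module FiveBreakers {m : ℕ} (s : Schedule (suc (suc m))) (feasible : Feasible s)
                    (single-break : SingleBreak s) (ranking-fair : RankingFair s) (m-even : even m ≡ true)
                    {a} (a∈ : IsRound (suc m) a) (8<M : 8 < suc m)
                    (run : ∀ {t} → t ≤ 4 → Cyclic.cyclic (suc m) (a + 2 * t) ∈ breakRounds s) where

  open FeasibleSchedule s feasible
  open SingleBreakSchedule s feasible single-break m-even
  open Cyclic M

  position : Fin 5 → ℕ
  position t = 2 * toℕ t

  position<M : ∀ t → position t < M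
  position<M t = ≤-<-trans (*-monoʳ-≤ 2 (s≤s⁻¹ (toℕ<n t))) 8<M

  breaker : ∀ t → ∃ λ x → HomeBreak x (cyclic (a + position t))
  breaker t with ∈-breakRounds⁻ s (run (s≤s⁻¹ (toℕ<n t)))
  ... | r∈ , z , z-breaks = hh-break r∈ z z-breaks

  team : Fin 5 → Team
  team t = proj₁ (breaker t)

  team-breaks : ∀ t → HomeBreak (team t) (cyclic (a + position t))
  team-breaks t = proj₂ (breaker t)

  team-home : ∀ t → EvenRankHome (team t)
  team-home t = even-rank-home ranking-fair {team t} (cyclic-isRound (a + position t)) (team-breaks t)

  team-injective : ∀ {p q} → p ≢ q → team p ≢ team q
  team-injective {p} {q} p≢q = breakers-distinct a∈ (position<M p) (position<M q)
    (p≢q ∘ toℕ-injective ∘ *-cancelˡ-≡ (toℕ p) (toℕ q) 2) (team-breaks p) (team-breaks q)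

  team-<-injective : ∀ {p q} → toℕ p < toℕ q → team p ≢ team q
  team-<-injective p<q = team-injective (<⇒≢ p<q ∘ cong toℕ)

  meeting : Fin 5 → Fin 5 → ℕ
  meeting p q = distance a (rnd s (team p) (team q))

  meeting-comm : ∀ {p q} → p ≢ q → meeting p q ≡ meeting q p
  meeting-comm p≢q = cong (distance a) (rnd-comm (team-injective p≢q))

  window : ∀ {p q} → toℕ p < toℕ q →
    position p ≤ meeting p q × meeting p q < position q × home s (team p) (team q) ≡ even (meeting p q)
  window {p} {q} p<q = meeting-window a∈ (*-monoʳ-< 2 p<q) (position<M q)
    (even-2* (toℕ p)) (even-2* (toℕ q)) (team-<-injective p<q) (team-breaks p) (team-breaks q)

  meeting-bounds : ∀ {p q} → toℕ p < toℕ q → position p ≤ meeting p q × meeting p q < position q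
  meeting-bounds p<q = proj₁ (window p<q) , proj₁ (proj₂ (window p<q))

  meeting-parity : ∀ {p q r} → toℕ p < toℕ q → toℕ q < toℕ r →
    even (meeting p q) ≡ even (meeting q r) → even (meeting p r) ≡ even (meeting p q)
  meeting-parity {p} {q} {r} p<q q<r eq = begin
    even (meeting p r)        ≡⟨ home≡even (<-trans p<q q<r) ⟨
    home s (team p) (team r)  ≡⟨ home-transitive (team-home p) (team-home q) (team-home r)
                                   (team-<-injective p<q) (team-<-injective q<r)
                                   (team-<-injective (<-trans p<q q<r))
                                   (trans (home≡even p<q) (trans eq (sym (home≡even q<r)))) ⟩
    home s (team p) (team q)  ≡⟨ home≡even p<q ⟩
    even (meeting p q)        ∎
    where
    open ≡-Reasoning
    home≡even : ∀ {p q} → toℕ p < toℕ q → home s (team p) (team q) ≡ even (meeting p q)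
    home≡even p<q = proj₂ (proj₂ (window p<q))

  meeting-injective : ∀ {p q r} → p ≢ q → p ≢ r → q ≢ r → meeting p q ≢ meeting p r
  meeting-injective p≢q p≢r q≢r eq = team-injective q≢r
    (rnd-injective (team-injective p≢q ∘ sym) (team-injective p≢r ∘ sym)
      (distance-injective a∈ (rnd-isRound (team-injective p≢q)) (rnd-isRound (team-injective p≢r)) eq))

  impossible : ⊥
  impossible =
    no-five-team-meeting-rounds meeting meeting-comm meeting-bounds meeting-parity meeting-injective

lemma6 : (n : ℕ) → 2 ∣ n → (s : Schedule n) →
    ¬ (Feasible s × SingleBreak s × RankingFair s ×
       ContainsUpToSymmetry (2 ∷ 2 ∷ 2 ∷ 2 ∷ []) (DSequence s))
lemma6 zero          _   s (_ , _ , _ , contains) = no-2222-in-[] contains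
lemma6 (suc zero)    2∣1 s _ with () ← 2∣⇒even 2∣1
lemma6 (suc (suc m)) 2∣n s (feasible , single-break , ranking-fair , contains)
  with CyclicRuns.run-of-five-breaks (suc m) (breakRounds-sorted s) (proj₁ ∘ ∈-breakRounds⁻ s) contains
... | 8≤M , a , a∈ , run =
  FiveBreakers.impossible s feasible single-break ranking-fair m-even a∈ 8<M run
  where
  m-even : even m ≡ true
  m-even = 2∣⇒even 2∣n
  8<M : 8 < suc m
  8<M = ≤∧≢⇒< 8≤M λ 8≡M →
    contradiction (trans (cong even 8≡M) (trans (even-suc m) (cong not m-even))) λ ()
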